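{- Let $X$ and $Y$ be finite sets of monomials in a polynomial ring over a field such that every $\xi\in X$ and every $\eta\in Y$ are coprime. Then $M(L(X\cup Y))=M(L(X))\,M(L(Y))$.
   Context: For a finite set $X$ of monomials, the lcm-lattice $L(X)$ is the set of least common multiples of all subsets of $X$ (the lcm of the empty set being $1$, the bottom element), ordered by divisibility. $\mu(x)=\mu(1,x)$ denotes the Möbius function of $L(X)$ on the interval $[1,x]$, and the Möbius sum is $M(L(X))=\sum_{x\in L(X)}\mu(x)\,x$, an element of the polynomial ring. -}

module Defs where

open import Data.Nat as ℕ using (ℕ; zero; suc; _⊔_; _⊓_; _≤_; _≤?_)
open import Data.Integer as ℤ using (ℤ; -_; 1ℤ; 0ℤ)
open import Data.Fin using (Fin)
open import Data.Vec as V using (Vec; zipWith; replicate; lookup)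
open import Data.Vec.Properties using (≡-dec)
open import Data.Vec.Relation.Binary.Pointwise.Inductive as PW using (Pointwise)
open import Data.List as L using (List; []; _∷_; map; filter; foldr; concatMap; deduplicate)
open import Data.List.Membership.Propositional using (_∈_)
open import Data.Product using (_×_; _,_; proj₁; proj₂)
open import Relation.Nullary using (Dec; yes; no; ¬_; _×-dec_; ¬?)
open import Relation.Binary.PropositionalEquality using (_≡_)
import Data.Nat.Properties as ℕP

sumℤ : List ℤ → ℤ
sumℤ = foldr ℤ._+_ 0ℤ

Mon : ℕ → Set
Mon n = Vec ℕ n

module _ {n : ℕ} where

  one : Mon n
  one = replicate n 0

  _·_ : Mon n → Mon n → Mon n
  _·_ = zipWith ℕ._+_

  lcm : Mon n → Mon n → Mon n
  lcm = zipWith _⊔_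

  gcd : Mon n → Mon n → Mon n
  gcd = zipWith _⊓_

  Coprime : Mon n → Mon n → Set
  Coprime a b = gcd a b ≡ one

  _∣_ : Mon n → Mon n → Set
  a ∣ b = Pointwise _≤_ a b

  _∣?_ : (a b : Mon n) → Dec (a ∣ b)
  a ∣? b = PW.decidable _≤?_ a b

  _≟_ : (a b : Mon n) → Dec (a ≡ b)
  _≟_ = ≡-dec ℕP._≟_

  _∣?<_ : (a b : Mon n) → Dec (a ∣ b × ¬ (a ≡ b))
  a ∣?< b = (a ∣? b) ×-dec ¬? (a ≟ b)

  lcmList : List (Mon n) → Mon n
  lcmList = foldr lcm one

  subsets : ∀ {a} {A : Set a} → List A → List (List A)
  subsets [] = [] ∷ []
  subsets (x ∷ xs) = let s = subsets xs in s L.++ map (x ∷_) s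

  lcmLattice : List (Mon n) → List (Mon n)
  lcmLattice X = deduplicate _≟_ (map lcmList (subsets X))

  deg : Mon n → ℕ
  deg = V.foldr _ ℕ._+_ 0

  -- Möbius function μ(1,x) of the poset P (a list of distinct elements
  -- containing 1), via μ(1,1)=1, μ(1,x) = - Σ_{y ∈ P, y < x} μ(1,y).
  -- The first argument is fuel; strict divisors have strictly smaller degree,
  -- so fuel deg x + 1 always suffices.
  μ-fuel : ℕ → List (Mon n) → Mon n → ℤ
  μ-fuel zero P x = 0ℤ
  μ-fuel (suc k) P x with x ≟ one
  ... | yes _ = 1ℤ
  ... | no _ = - sumℤ (map (μ-fuel k P) (filter (_∣?< x) P))

  μ : List (Mon n) → Mon n → ℤ
  μ P x = μ-fuel (suc (deg x)) P x

  -- Polynomials with integer coefficients: formal finite sums Σ cᵢ mᵢ,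
  -- compared via their coefficient functions.
  Poly : Set
  Poly = List (ℤ × Mon n)

  coeff : Poly → Mon n → ℤ
  coeff p m = sumℤ (map proj₁ (filter (λ t → proj₂ t ≟ m) p))

  _≈_ : Poly → Poly → Set
  p ≈ q = ∀ m → coeff p m ≡ coeff q m

  _*_ : Poly → Poly → Poly
  p * q = concatMap (λ s → map (λ t → (proj₁ s ℤ.* proj₁ t , proj₂ s · proj₂ t)) q) p

  M : List (Mon n) → Poly
  M X = map (λ x → (μ P x , x)) P
    where P = lcmLattice X

-- Since every ξ ∈ X is coprime to every η ∈ Y, all elements of L(X) have support disjoint from
-- all elements of L(Y). Hence every element of L(X ∪ Y) factors uniquely as x · y = lcm(x, y) with
-- x ∈ L(X), y ∈ L(Y), and x' · y' divides x · y iff x' ∣ x and y' ∣ y: the lattice L(X ∪ Y) is the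
-- product poset L(X) × L(Y). Divisor sums over L(X ∪ Y) therefore factor, which makes the Möbius
-- function multiplicative, μ(x · y) = μ(x) μ(y), and M(L(X ∪ Y)) = M(L(X)) M(L(Y)) follows by
-- comparing coefficients.
module Submission where

open import Data.Nat as ℕ using (ℕ; zero; suc; _≤_; _<_; z≤n; s≤s; _⊓_)
import Data.Nat.Properties as ℕP
open import Data.Integer as ℤ using (ℤ; 0ℤ; 1ℤ; -_; _+_; _-_)
import Data.Integer.Properties as ℤP
open import Data.Integer.Tactic.RingSolver using (solve-∀)
open import Data.Vec using ([]; _∷_)
open import Data.Vec.Properties using (∷-injective; zipWith-assoc; zipWith-identityˡ)
open import Data.Vec.Relation.Binary.Pointwise.Inductive as PW using (Pointwise; []; _∷_)
open import Data.List using (List; []; _∷_; map; filter; concatMap; _++_)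
import Data.List.Properties as LP
open import Data.List.Membership.Propositional using (_∈_; _∉_)
open import Data.List.Membership.Propositional.Properties
  using (∈-map⁺; ∈-map⁻; ∈-++⁺ˡ; ∈-++⁺ʳ; ∈-++⁻; ∈-filter⁻; ∈-deduplicate⁺; ∈-deduplicate⁻)
open import Data.List.Relation.Unary.Any using (here; there)
open import Data.List.Relation.Unary.All.Properties using (All¬⇒¬Any)
open import Data.List.Relation.Unary.AllPairs using (_∷_)
open import Data.List.Relation.Unary.Unique.Propositional using (Unique)
import Data.List.Relation.Unary.Unique.DecPropositional.Properties as Unique
open import Data.Product using (_×_; _,_; proj₁; proj₂; ∃; ∃₂)
open import Data.Sum using (_⊎_; inj₁; inj₂; swap)
open import Data.Empty using (⊥-elim)
open import Function using (_∘_)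
open import Relation.Nullary using (Dec; yes; no)
open import Relation.Unary using (Decidable)
open import Relation.Binary.Definitions using (DecidableEquality)
open import Relation.Binary.PropositionalEquality

open import Defs

∑ : {A : Set} → List A → (A → ℤ) → ℤ
∑ L f = sumℤ (map f L)

infix 5 ∑
syntax ∑ L (λ z → e) = ∑[ z ∈ L ] e

module _ {A : Set} where

  ∑-cong : (L : List A) {f g : A → ℤ} → (∀ {z} → z ∈ L → f z ≡ g z) → ∑ L f ≡ ∑ L g
  ∑-cong []      f≡g = refl
  ∑-cong (x ∷ L) f≡g = cong₂ _+_ (f≡g (here refl)) (∑-cong L (f≡g ∘ there))

  ∑-zero : (L : List A) → ∑[ z ∈ L ] 0ℤ ≡ 0ℤ
  ∑-zero []      = refl
  ∑-zero (x ∷ L) = trans (ℤP.+-identityˡ _) (∑-zero L)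

  ∑-++ : (L K : List A) (f : A → ℤ) → ∑ (L ++ K) f ≡ ∑ L f + ∑ K f
  ∑-++ []      K f = sym (ℤP.+-identityˡ _)
  ∑-++ (x ∷ L) K f = trans (cong (f x +_) (∑-++ L K f)) (sym (ℤP.+-assoc (f x) _ _))

  ∑-+ : (L : List A) (f g : A → ℤ) → ∑[ z ∈ L ] (f z + g z) ≡ ∑ L f + ∑ L g
  ∑-+ []      f g = refl
  ∑-+ (x ∷ L) f g = trans (cong (f x + g x +_) (∑-+ L f g)) (interchange (f x) (g x) _ _)
    where
    interchange : ∀ a b c d → (a + b) + (c + d) ≡ (a + c) + (b + d)
    interchange = solve-∀

  ∑-sub : (L : List A) (f g : A → ℤ) → ∑[ z ∈ L ] (f z - g z) ≡ ∑ L f - ∑ L g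
  ∑-sub []      f g = refl
  ∑-sub (x ∷ L) f g = trans (cong (f x - g x +_) (∑-sub L f g)) (interchange (f x) (g x) _ _)
    where
    interchange : ∀ a b c d → (a - b) + (c - d) ≡ (a + c) - (b + d)
    interchange = solve-∀

  ∑-*ˡ : (L : List A) (c : ℤ) (f : A → ℤ) → ∑[ z ∈ L ] (c ℤ.* f z) ≡ c ℤ.* ∑ L f
  ∑-*ˡ []      c f = sym (ℤP.*-zeroʳ c)
  ∑-*ˡ (x ∷ L) c f = trans (cong (c ℤ.* f x +_) (∑-*ˡ L c f)) (sym (ℤP.*-distribˡ-+ c (f x) _))

  ∑-*ʳ : (L : List A) (c : ℤ) (f : A → ℤ) → ∑[ z ∈ L ] (f z ℤ.* c) ≡ ∑ L f ℤ.* c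
  ∑-*ʳ []      c f = sym (ℤP.*-zeroˡ c)
  ∑-*ʳ (x ∷ L) c f = trans (cong (f x ℤ.* c +_) (∑-*ʳ L c f)) (sym (ℤP.*-distribʳ-+ c (f x) _))

  ∑-map : {B : Set} (g : B → A) (L : List B) (f : A → ℤ) → ∑ (map g L) f ≡ ∑ L (f ∘ g)
  ∑-map g L f = cong sumℤ (sym (LP.map-∘ L))

  ∑-concatMap : {B : Set} (h : B → List A) (L : List B) (f : A → ℤ) →
    ∑ (concatMap h L) f ≡ ∑[ s ∈ L ] ∑ (h s) f
  ∑-concatMap h []      f = refl
  ∑-concatMap h (x ∷ L) f = trans (∑-++ (h x) (concatMap h L) f) (cong (∑ (h x) f +_) (∑-concatMap h L f))

module _ {A B : Set} where

  ∑-comm : (L : List A) (K : List B) (f : A → B → ℤ) →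
    ∑[ x ∈ L ] ∑[ y ∈ K ] f x y ≡ ∑[ y ∈ K ] ∑[ x ∈ L ] f x y
  ∑-comm []      K f = sym (∑-zero K)
  ∑-comm (x ∷ L) K f = trans (cong (∑ K (f x) +_) (∑-comm L K f)) (sym (∑-+ K (f x) _))

  ∑-*-∑ : (L : List A) (K : List B) (f : A → ℤ) (g : B → ℤ) →
    ∑[ x ∈ L ] ∑[ y ∈ K ] (f x ℤ.* g y) ≡ ∑ L f ℤ.* ∑ K g
  ∑-*-∑ L K f g = trans (∑-cong L (λ {x} _ → ∑-*ˡ K (f x) g)) (∑-*ʳ L (∑ K g) f)

  ∑-∑-sub : (L : List A) (K : List B) (f g : A → B → ℤ) →
    ∑[ x ∈ L ] ∑[ y ∈ K ] (f x y - g x y)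
      ≡ (∑[ x ∈ L ] ∑[ y ∈ K ] f x y) - (∑[ x ∈ L ] ∑[ y ∈ K ] g x y)
  ∑-∑-sub L K f g = trans (∑-cong L (λ {x} _ → ∑-sub K (f x) (g x))) (∑-sub L _ _)

δ : {B : Set} → Dec B → ℤ → ℤ
δ (yes _) v = v
δ (no _)  v = 0ℤ

δ-cong : {B : Set} (b : Dec B) {u v : ℤ} → (B → u ≡ v) → δ b u ≡ δ b v
δ-cong (yes p) u≡v = u≡v p
δ-cong (no _)  u≡v = refl

δ-* : {B C : Set} (b : Dec B) (c : Dec C) (u v : ℤ) → δ b u ℤ.* δ c v ≡ δ b (δ c (u ℤ.* v))
δ-* (yes _) (yes _) u v = refl
δ-* (yes _) (no _)  u v = ℤP.*-zeroʳ u
δ-* (no _)  c       u v = ℤP.*-zeroˡ (δ c v)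

δ-× : {B C D : Set} (d : Dec D) (b : Dec B) (c : Dec C) → (D → B × C) → (B → C → D) →
  (v : ℤ) → δ d v ≡ δ b (δ c v)
δ-× (yes d) (yes _) (yes _) D⇒B×C B⇒C⇒D v = refl
δ-× (yes d) (yes _) (no ¬c) D⇒B×C B⇒C⇒D v = ⊥-elim (¬c (proj₂ (D⇒B×C d)))
δ-× (yes d) (no ¬b) c       D⇒B×C B⇒C⇒D v = ⊥-elim (¬b (proj₁ (D⇒B×C d)))
δ-× (no ¬d) (yes b) (yes c) D⇒B×C B⇒C⇒D v = ⊥-elim (¬d (B⇒C⇒D b c))
δ-× (no ¬d) (yes _) (no _)  D⇒B×C B⇒C⇒D v = refl
δ-× (no ¬d) (no _)  c       D⇒B×C B⇒C⇒D v = refl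

∑-filter : {A : Set} {P : A → Set} (P? : Decidable P) (L : List A) (f : A → ℤ) →
  ∑ (filter P? L) f ≡ ∑[ z ∈ L ] δ (P? z) (f z)
∑-filter P? []      f = refl
∑-filter P? (x ∷ L) f with P? x
... | yes _ = cong (f x +_) (∑-filter P? L f)
... | no _  = trans (∑-filter P? L f) (sym (ℤP.+-identityˡ _))

module _ {A : Set} (_≟ᴬ_ : DecidableEquality A) where

  ∑-δ-∉ : (L : List A) {w : A} (f : A → ℤ) → w ∉ L → ∑[ z ∈ L ] δ (z ≟ᴬ w) (f z) ≡ 0ℤ
  ∑-δ-∉ []      f w∉L = refl
  ∑-δ-∉ (x ∷ L) {w} f w∉L with x ≟ᴬ w
  ... | yes refl = ⊥-elim (w∉L (here refl))
  ... | no _     = trans (ℤP.+-identityˡ _) (∑-δ-∉ L f (w∉L ∘ there))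

  ∑-δ : (L : List A) → Unique L → {w : A} (f : A → ℤ) → w ∈ L →
    ∑[ z ∈ L ] δ (z ≟ᴬ w) (f z) ≡ f w
  ∑-δ (x ∷ L) (x∉L ∷ L!) {w} f w∈ with x ≟ᴬ w | w∈
  ... | yes refl | _       = trans (cong (f x +_) (∑-δ-∉ L f (All¬⇒¬Any x∉L))) (ℤP.+-identityʳ _)
  ... | no x≢w   | here w≡x = ⊥-elim (x≢w (sym w≡x))
  ... | no _     | there w∈L = trans (ℤP.+-identityˡ _) (∑-δ L L! f w∈L)

private variable
  m : ℕ

deg-mono : {a b : Mon m} → a ∣ b → deg a ≤ deg b
deg-mono []         = z≤n
deg-mono (a≤b ∷ as) = ℕP.+-mono-≤ a≤b (deg-mono as)

∣∧deg≡⇒≡ : {a b : Mon m} → a ∣ b → deg a ≡ deg b → a ≡ b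
∣∧deg≡⇒≡ [] _ = refl
∣∧deg≡⇒≡ {a = x ∷ _} (x≤y ∷ as) deg≡ with ℕP.m≤n⇒m<n∨m≡n x≤y
... | inj₁ x<y  = ⊥-elim (ℕP.<⇒≢ (ℕP.+-mono-<-≤ x<y (deg-mono as)) deg≡)
... | inj₂ refl = cong (x ∷_) (∣∧deg≡⇒≡ as (ℕP.+-cancelˡ-≡ x _ _ deg≡))

deg-mono-< : {a b : Mon m} → a ∣ b → a ≢ b → deg a < deg b
deg-mono-< a∣b a≢b with ℕP.m≤n⇒m<n∨m≡n (deg-mono a∣b)
... | inj₁ lt   = lt
... | inj₂ deg≡ = ⊥-elim (a≢b (∣∧deg≡⇒≡ a∣b deg≡))

∣-refl : {a : Mon m} → a ∣ a
∣-refl = PW.refl ℕP.≤-refl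

∣one⇒≡one : {a : Mon m} → a ∣ one → a ≡ one
∣one⇒≡one []         = refl
∣one⇒≡one (a≤0 ∷ as) = cong₂ _∷_ (ℕP.n≤0⇒n≡0 a≤0) (∣one⇒≡one as)

module _ {n : ℕ} where

  δ-∣?-split : (z x : Mon n) (v : ℤ) → δ (z ∣? x) v ≡ δ (z ∣?< x) v + δ (z ≟ x) v
  δ-∣?-split z x v with z ∣? x | z ≟ x
  ... | yes _   | yes _ = sym (ℤP.+-identityˡ v)
  ... | yes _   | no _  = sym (ℤP.+-identityʳ v)
  ... | no z∤x  | yes refl = ⊥-elim (z∤x ∣-refl)
  ... | no _    | no _  = refl

  δ-∣?< : (z x : Mon n) (v : ℤ) → δ (z ∣?< x) v ≡ δ (z ∣? x) v - δ (z ≟ x) v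
  δ-∣?< z x v with z ∣? x | z ≟ x
  ... | yes _   | yes _ = sym (ℤP.+-inverseʳ v)
  ... | yes _   | no _  = sym (ℤP.+-identityʳ v)
  ... | no z∤x  | yes refl = ⊥-elim (z∤x ∣-refl)
  ... | no _    | no _  = refl

module _ {n : ℕ} (P : List (Mon n)) where

  deg-<-strict-divisors : ∀ {x z} → z ∈ filter (_∣?< x) P → deg z < deg x
  deg-<-strict-divisors {x} z∈ =
    let z∣x , z≢x = proj₂ (∈-filter⁻ (_∣?< x) {xs = P} z∈) in deg-mono-< z∣x z≢x

  μ-fuel-irrelevant : ∀ k k' x → deg x < k → deg x < k' → μ-fuel k P x ≡ μ-fuel k' P x
  μ-fuel-irrelevant (suc k) (suc k') x (s≤s deg<k) (s≤s deg<k') with x ≟ one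
  ... | yes _ = refl
  ... | no _  = cong -_ (∑-cong (filter (_∣?< x) P) λ z∈ →
    let deg< = deg-<-strict-divisors z∈
    in μ-fuel-irrelevant k k' _ (ℕP.<-≤-trans deg< deg<k) (ℕP.<-≤-trans deg< deg<k'))

  μ-unfold : (x : Mon n) → μ P x ≡ δ (x ≟ one) 1ℤ - (∑[ z ∈ P ] δ (z ∣?< x) (μ P z))
  μ-unfold x with x ≟ one
  ... | yes refl = sym (cong (_-_ 1ℤ) (trans (∑-cong P nothing-below-one) (∑-zero P)))
    where
    nothing-below-one : ∀ {z} → z ∈ P → δ (z ∣?< one) (μ P z) ≡ 0ℤ
    nothing-below-one {z} _ with z ∣?< one
    ... | yes (z∣1 , z≢1) = ⊥-elim (z≢1 (∣one⇒≡one z∣1))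
    ... | no _            = refl
  ... | no _ = begin
    - ∑ (filter (_∣?< x) P) (μ-fuel (deg x) P)
      ≡⟨ cong -_ (∑-cong (filter (_∣?< x) P) λ z∈ →
           μ-fuel-irrelevant _ _ _ (deg-<-strict-divisors z∈) ℕP.≤-refl) ⟩
    - ∑ (filter (_∣?< x) P) (μ P)
      ≡⟨ cong -_ (∑-filter (_∣?< x) P (μ P)) ⟩
    - (∑[ z ∈ P ] δ (z ∣?< x) (μ P z))
      ≡⟨ ℤP.+-identityˡ _ ⟨
    0ℤ - (∑[ z ∈ P ] δ (z ∣?< x) (μ P z)) ∎
    where open ≡-Reasoning

  ∑-divisors-μ : Unique P → {x : Mon n} → x ∈ P → ∑[ z ∈ P ] δ (z ∣? x) (μ P z) ≡ δ (x ≟ one) 1ℤ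
  ∑-divisors-μ P! {x} x∈P = begin
    ∑[ z ∈ P ] δ (z ∣? x) (μ P z)
      ≡⟨ ∑-cong P (λ {z} _ → δ-∣?-split z x (μ P z)) ⟩
    ∑[ z ∈ P ] (δ (z ∣?< x) (μ P z) + δ (z ≟ x) (μ P z))
      ≡⟨ ∑-+ P _ _ ⟩
    below + (∑[ z ∈ P ] δ (z ≟ x) (μ P z))
      ≡⟨ cong (below +_) (∑-δ _≟_ P P! (μ P) x∈P) ⟩
    below + μ P x
      ≡⟨ cong (below +_) (μ-unfold x) ⟩
    below + (δ (x ≟ one) 1ℤ - below)
      ≡⟨ cancel below _ ⟩
    δ (x ≟ one) 1ℤ ∎
    where
    open ≡-Reasoning
    below : ℤ
    below = ∑[ z ∈ P ] δ (z ∣?< x) (μ P z)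
    cancel : ∀ s d → s + (d - s) ≡ d
    cancel = solve-∀

Disjoint : Mon m → Mon m → Set
Disjoint = Pointwise (λ a b → a ≡ 0 ⊎ b ≡ 0)

m⊓n≡0⇒m≡0∨n≡0 : ∀ a b → a ⊓ b ≡ 0 → a ≡ 0 ⊎ b ≡ 0
m⊓n≡0⇒m≡0∨n≡0 zero    _    _ = inj₁ refl
m⊓n≡0⇒m≡0∨n≡0 (suc _) zero _ = inj₂ refl

+-cross-injective : ∀ {a b a' b'} → a ≡ 0 ⊎ b' ≡ 0 → a' ≡ 0 ⊎ b ≡ 0 →
  a ℕ.+ b ≡ a' ℕ.+ b' → a ≡ a' × b ≡ b'
+-cross-injective (inj₁ refl) (inj₁ refl) eq = refl , eq
+-cross-injective {a' = a'} (inj₁ refl) (inj₂ refl) eq =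
  sym (ℕP.m+n≡0⇒m≡0 a' (sym eq)) , sym (ℕP.m+n≡0⇒n≡0 a' (sym eq))
+-cross-injective {a} (inj₂ refl) (inj₁ refl) eq = ℕP.m+n≡0⇒m≡0 a eq , ℕP.m+n≡0⇒n≡0 a eq
+-cross-injective {a} {a' = a'} (inj₂ refl) (inj₂ refl) eq = ℕP.+-cancelʳ-≡ 0 a a' eq , refl

+-cross-cancel-≤ : ∀ {a b a' b'} → a ≡ 0 ⊎ b' ≡ 0 → a' ≡ 0 ⊎ b ≡ 0 →
  a' ℕ.+ b' ≤ a ℕ.+ b → a' ≤ a × b' ≤ b
+-cross-cancel-≤ (inj₁ refl) (inj₁ refl) le = z≤n , le
+-cross-cancel-≤ {a' = a'} (inj₁ refl) (inj₂ refl) le = ℕP.m+n≤o⇒m≤o a' le , ℕP.m+n≤o⇒n≤o a' le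
+-cross-cancel-≤ (inj₂ refl) (inj₁ refl) le = z≤n , z≤n
+-cross-cancel-≤ {a} {a' = a'} (inj₂ refl) (inj₂ refl) le = ℕP.+-cancelʳ-≤ 0 a' a le , z≤n

coprime⇒disjoint : {a b : Mon m} → Coprime a b → Disjoint a b
coprime⇒disjoint {a = []}    {[]}    _   = []
coprime⇒disjoint {a = x ∷ _} {y ∷ _} eq =
  m⊓n≡0⇒m≡0∨n≡0 x y (proj₁ (∷-injective eq)) ∷ coprime⇒disjoint (proj₂ (∷-injective eq))

disjoint-sym : {a b : Mon m} → Disjoint a b → Disjoint b a
disjoint-sym = PW.sym swap

one-disjoint : (b : Mon m) → Disjoint one b
one-disjoint []      = []
one-disjoint (_ ∷ b) = inj₁ refl ∷ one-disjoint b

lcm-disjoint : {a b c : Mon m} → Disjoint a c → Disjoint b c → Disjoint (lcm a b) c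
lcm-disjoint []                 []                 = []
lcm-disjoint (inj₂ c≡0  ∷ a⊥c) (_           ∷ b⊥c) = inj₂ c≡0 ∷ lcm-disjoint a⊥c b⊥c
lcm-disjoint (inj₁ refl ∷ a⊥c) (b₀⊥c₀       ∷ b⊥c) = b₀⊥c₀ ∷ lcm-disjoint a⊥c b⊥c

lcmList-disjoint : (S : List (Mon m)) {c : Mon m} → (∀ {s} → s ∈ S → Disjoint s c) →
  Disjoint (lcmList S) c
lcmList-disjoint []      {c} _   = one-disjoint c
lcmList-disjoint (s ∷ S) S⊥c = lcm-disjoint (S⊥c (here refl)) (lcmList-disjoint S (S⊥c ∘ there))

lcm≡·-disjoint : {a b : Mon m} → Disjoint a b → lcm a b ≡ a · b
lcm≡·-disjoint []                 = refl
lcm≡·-disjoint {a = x ∷ _} (inj₁ refl ∷ a⊥b) = cong (_ ∷_) (lcm≡·-disjoint a⊥b)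
lcm≡·-disjoint {a = x ∷ _} (inj₂ refl ∷ a⊥b) =
  cong₂ _∷_ (trans (ℕP.⊔-identityʳ x) (sym (ℕP.+-identityʳ x))) (lcm≡·-disjoint a⊥b)

·-identityˡ : (a : Mon m) → one · a ≡ a
·-identityˡ = zipWith-identityˡ ℕP.+-identityˡ

·≡one⇒ : (a b : Mon m) → a · b ≡ one → a ≡ one × b ≡ one
·≡one⇒ []      []      _  = refl , refl
·≡one⇒ (x ∷ a) (y ∷ b) eq =
  let x+y≡0 , ab≡1 = ∷-injective eq
      a≡1 , b≡1 = ·≡one⇒ a b ab≡1
  in cong₂ _∷_ (ℕP.m+n≡0⇒m≡0 x x+y≡0) a≡1 , cong₂ _∷_ (ℕP.m+n≡0⇒n≡0 x x+y≡0) b≡1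

·-mono-∣ : {a b a' b' : Mon m} → a' ∣ a → b' ∣ b → (a' · b') ∣ (a · b)
·-mono-∣ []       []       = []
·-mono-∣ (p ∷ ps) (q ∷ qs) = ℕP.+-mono-≤ p q ∷ ·-mono-∣ ps qs

·-cross-injective : {a b a' b' : Mon m} → Disjoint a b' → Disjoint a' b →
  a · b ≡ a' · b' → a ≡ a' × b ≡ b'
·-cross-injective []       []       _  = refl , refl
·-cross-injective (c ∷ cs) (d ∷ ds) eq =
  let x+y≡ , xs+ys≡ = ∷-injective eq
      x≡ , y≡ = +-cross-injective c d x+y≡
      xs≡ , ys≡ = ·-cross-injective cs ds xs+ys≡
  in cong₂ _∷_ x≡ xs≡ , cong₂ _∷_ y≡ ys≡

·-cross-cancel-∣ : {a b a' b' : Mon m} → Disjoint a b' → Disjoint a' b →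
  (a' · b') ∣ (a · b) → a' ∣ a × b' ∣ b
·-cross-cancel-∣ []       []       []       = [] , []
·-cross-cancel-∣ (c ∷ cs) (d ∷ ds) (p ∷ ps) =
  let x' , y' = +-cross-cancel-≤ c d p
      xs' , ys' = ·-cross-cancel-∣ cs ds ps
  in x' ∷ xs' , y' ∷ ys'

δ-≟one-· : (a b : Mon m) → δ ((a · b) ≟ one) 1ℤ ≡ δ (a ≟ one) 1ℤ ℤ.* δ (b ≟ one) 1ℤ
δ-≟one-· a b = trans
  (δ-× ((a · b) ≟ one) (a ≟ one) (b ≟ one) (·≡one⇒ a b) (λ { refl refl → ·-identityˡ one }) 1ℤ)
  (sym (δ-* (a ≟ one) (b ≟ one) 1ℤ 1ℤ))

module Product {n : ℕ} (P Q R : List (Mon n)) (P! : Unique P) (Q! : Unique Q) (R! : Unique R)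
  (P⊥Q : ∀ {x y} → x ∈ P → y ∈ Q → Disjoint x y)
  (·∈R : ∀ {x y} → x ∈ P → y ∈ Q → (x · y) ∈ R)
  (R⊆P·Q : ∀ {z} → z ∈ R → ∃₂ λ x y → x ∈ P × y ∈ Q × z ≡ x · y)
  where

  ∑-R≡∑∑ : (h : Mon n → ℤ) → ∑ R h ≡ ∑[ x ∈ P ] ∑[ y ∈ Q ] h (x · y)
  ∑-R≡∑∑ h = sym (begin
    ∑[ x ∈ P ] ∑[ y ∈ Q ] h (x · y)
      ≡⟨ ∑-cong P (λ x∈P → ∑-cong Q (λ y∈Q → sym (∑-δ _≟_ R R! h (·∈R x∈P y∈Q)))) ⟩
    ∑[ x ∈ P ] ∑[ y ∈ Q ] ∑[ z ∈ R ] δ (z ≟ (x · y)) (h z)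
      ≡⟨ ∑-cong P (λ {x} _ → ∑-comm Q R (λ y z → δ (z ≟ (x · y)) (h z))) ⟩
    ∑[ x ∈ P ] ∑[ z ∈ R ] ∑[ y ∈ Q ] δ (z ≟ (x · y)) (h z)
      ≡⟨ ∑-comm P R _ ⟩
    ∑[ z ∈ R ] ∑[ x ∈ P ] ∑[ y ∈ Q ] δ (z ≟ (x · y)) (h z)
      ≡⟨ ∑-cong R factorisation-unique ⟩
    ∑ R h ∎)
    where
    open ≡-Reasoning
    factorisation-unique : ∀ {z} → z ∈ R → ∑[ x ∈ P ] ∑[ y ∈ Q ] δ (z ≟ (x · y)) (h z) ≡ h z
    factorisation-unique z∈R with R⊆P·Q z∈R
    ... | p , q , p∈P , q∈Q , refl = begin
      ∑[ x ∈ P ] ∑[ y ∈ Q ] δ ((p · q) ≟ (x · y)) (h (p · q))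
        ≡⟨ ∑-cong P (λ {x} x∈P → ∑-cong Q (λ {y} y∈Q →
             δ-× ((p · q) ≟ (x · y)) (y ≟ q) (x ≟ p)
               (λ eq → let p≡x , q≡y = ·-cross-injective (P⊥Q p∈P y∈Q) (P⊥Q x∈P q∈Q) eq
                       in sym q≡y , sym p≡x)
               (λ { refl refl → refl }) _)) ⟩
      ∑[ x ∈ P ] ∑[ y ∈ Q ] δ (y ≟ q) (δ (x ≟ p) (h (p · q)))
        ≡⟨ ∑-cong P (λ {x} _ → ∑-δ _≟_ Q Q! (λ _ → δ (x ≟ p) (h (p · q))) q∈Q) ⟩
      ∑[ x ∈ P ] δ (x ≟ p) (h (p · q))
        ≡⟨ ∑-δ _≟_ P P! (λ _ → h (p · q)) p∈P ⟩
      h (p · q) ∎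

  ∑-δ-· : {_~_ : Mon n → Mon n → Set} (_~?_ : ∀ a b → Dec (a ~ b)) {x y : Mon n} →
    (∀ {x' y'} → x' ∈ P → y' ∈ Q → (x' · y') ~ (x · y) → x' ~ x × y' ~ y) →
    (∀ {x' y'} → x' ~ x → y' ~ y → (x' · y') ~ (x · y)) →
    (f g : Mon n → ℤ) →
    ∑[ x' ∈ P ] ∑[ y' ∈ Q ] δ ((x' · y') ~? (x · y)) (f x' ℤ.* g y')
      ≡ (∑[ x' ∈ P ] δ (x' ~? x) (f x')) ℤ.* (∑[ y' ∈ Q ] δ (y' ~? y) (g y'))
  ∑-δ-· _~?_ {x} {y} split join f g = begin
    ∑[ x' ∈ P ] ∑[ y' ∈ Q ] δ ((x' · y') ~? (x · y)) (f x' ℤ.* g y')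
      ≡⟨ ∑-cong P (λ {x'} x'∈P → ∑-cong Q (λ {y'} y'∈Q →
           trans (δ-× ((x' · y') ~? (x · y)) (x' ~? x) (y' ~? y) (split x'∈P y'∈Q) join _)
                 (sym (δ-* (x' ~? x) (y' ~? y) (f x') (g y'))))) ⟩
    ∑[ x' ∈ P ] ∑[ y' ∈ Q ] (δ (x' ~? x) (f x') ℤ.* δ (y' ~? y) (g y'))
      ≡⟨ ∑-*-∑ P Q _ _ ⟩
    (∑[ x' ∈ P ] δ (x' ~? x) (f x')) ℤ.* (∑[ y' ∈ Q ] δ (y' ~? y) (g y')) ∎
    where open ≡-Reasoning

  ∑-∑-strict-divisors : ∀ {x y} → x ∈ P → y ∈ Q →
    ∑[ x' ∈ P ] ∑[ y' ∈ Q ] δ ((x' · y') ∣?< (x · y)) (μ P x' ℤ.* μ Q y')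
      ≡ δ (x ≟ one) 1ℤ ℤ.* δ (y ≟ one) 1ℤ - μ P x ℤ.* μ Q y
  ∑-∑-strict-divisors {x} {y} x∈P y∈Q = begin
    ∑[ x' ∈ P ] ∑[ y' ∈ Q ] δ ((x' · y') ∣?< (x · y)) (μ P x' ℤ.* μ Q y')
      ≡⟨ ∑-cong P (λ {x'} _ → ∑-cong Q (λ {y'} _ → δ-∣?< (x' · y') (x · y) _)) ⟩
    ∑[ x' ∈ P ] ∑[ y' ∈ Q ] (δ ((x' · y') ∣? (x · y)) (μ P x' ℤ.* μ Q y')
                            - δ ((x' · y') ≟ (x · y)) (μ P x' ℤ.* μ Q y'))
      ≡⟨ ∑-∑-sub P Q _ _ ⟩
    (∑[ x' ∈ P ] ∑[ y' ∈ Q ] δ ((x' · y') ∣? (x · y)) (μ P x' ℤ.* μ Q y'))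
      - (∑[ x' ∈ P ] ∑[ y' ∈ Q ] δ ((x' · y') ≟ (x · y)) (μ P x' ℤ.* μ Q y'))
      ≡⟨ cong₂ _-_
           (∑-δ-· _∣?_ (λ x'∈P y'∈Q → ·-cross-cancel-∣ (P⊥Q x∈P y'∈Q) (P⊥Q x'∈P y∈Q))
                       ·-mono-∣ (μ P) (μ Q))
           (∑-δ-· _≟_ (λ x'∈P y'∈Q → ·-cross-injective (P⊥Q x'∈P y∈Q) (P⊥Q x∈P y'∈Q))
                      (λ { refl refl → refl }) (μ P) (μ Q)) ⟩
    (∑[ x' ∈ P ] δ (x' ∣? x) (μ P x')) ℤ.* (∑[ y' ∈ Q ] δ (y' ∣? y) (μ Q y'))
      - (∑[ x' ∈ P ] δ (x' ≟ x) (μ P x')) ℤ.* (∑[ y' ∈ Q ] δ (y' ≟ y) (μ Q y'))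
      ≡⟨ cong₂ _-_
           (cong₂ ℤ._*_ (∑-divisors-μ P P! x∈P) (∑-divisors-μ Q Q! y∈Q))
           (cong₂ ℤ._*_ (∑-δ _≟_ P P! (μ P) x∈P) (∑-δ _≟_ Q Q! (μ Q) y∈Q)) ⟩
    δ (x ≟ one) 1ℤ ℤ.* δ (y ≟ one) 1ℤ - μ P x ℤ.* μ Q y ∎
    where open ≡-Reasoning

  μ-multiplicative : ∀ {x y} → x ∈ P → y ∈ Q → μ R (x · y) ≡ μ P x ℤ.* μ Q y
  μ-multiplicative = go _ ℕP.≤-refl
    where
    go : ∀ k {x y} → deg (x · y) < k → x ∈ P → y ∈ Q → μ R (x · y) ≡ μ P x ℤ.* μ Q y
    go (suc k) {x} {y} (s≤s deg≤k) x∈P y∈Q = begin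
      μ R (x · y)
        ≡⟨ μ-unfold R (x · y) ⟩
      δ ((x · y) ≟ one) 1ℤ - (∑[ z ∈ R ] δ (z ∣?< (x · y)) (μ R z))
        ≡⟨ cong₂ _-_ (δ-≟one-· x y) (∑-R≡∑∑ _) ⟩
      unit - (∑[ x' ∈ P ] ∑[ y' ∈ Q ] δ ((x' · y') ∣?< (x · y)) (μ R (x' · y')))
        ≡⟨ cong (_-_ unit) (∑-cong P (λ x'∈P → ∑-cong Q (λ y'∈Q → δ-cong ((_ · _) ∣?< (x · y))
             λ (d , d≢) → go k (ℕP.<-≤-trans (deg-mono-< d d≢) deg≤k) x'∈P y'∈Q))) ⟩
      unit - (∑[ x' ∈ P ] ∑[ y' ∈ Q ] δ ((x' · y') ∣?< (x · y)) (μ P x' ℤ.* μ Q y'))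
        ≡⟨ cong (_-_ unit) (∑-∑-strict-divisors x∈P y∈Q) ⟩
      unit - (unit - μ P x ℤ.* μ Q y)
        ≡⟨ cancel unit (μ P x ℤ.* μ Q y) ⟩
      μ P x ℤ.* μ Q y ∎
      where
      open ≡-Reasoning
      unit : ℤ
      unit = δ (x ≟ one) 1ℤ ℤ.* δ (y ≟ one) 1ℤ
      cancel : ∀ a b → a - (a - b) ≡ b
      cancel = solve-∀

module _ {n : ℕ} where

  -- Defs' subsets takes the ambient n as an implicit argument that its type does not determine.
  subsetsᴹ : List (Mon n) → List (List (Mon n))
  subsetsᴹ = subsets {n = n}

  ∈subsets⇒⊆ : (X : List (Mon n)) {S : List (Mon n)} → S ∈ subsetsᴹ X → ∀ {s} → s ∈ S → s ∈ X
  ∈subsets⇒⊆ []      (here refl) ()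
  ∈subsets⇒⊆ (x ∷ X) S∈ s∈S with ∈-++⁻ (subsetsᴹ X) S∈
  ... | inj₁ S∈X = there (∈subsets⇒⊆ X S∈X s∈S)
  ... | inj₂ S∈x∷X with ∈-map⁻ (x ∷_) S∈x∷X | s∈S
  ...   | _ , _   , refl | here refl = here refl
  ...   | _ , S∈X , refl | there s∈S′ = there (∈subsets⇒⊆ X S∈X s∈S′)

  subsets-++⁺ : (X Y : List (Mon n)) {S T : List (Mon n)} →
    S ∈ subsetsᴹ X → T ∈ subsetsᴹ Y → (S ++ T) ∈ subsetsᴹ (X ++ Y)
  subsets-++⁺ []      Y (here refl) T∈ = T∈
  subsets-++⁺ (x ∷ X) Y S∈ T∈ with ∈-++⁻ (subsetsᴹ X) S∈
  ... | inj₁ S∈X = ∈-++⁺ˡ (subsets-++⁺ X Y S∈X T∈)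
  ... | inj₂ S∈x∷X with ∈-map⁻ (x ∷_) S∈x∷X
  ...   | _ , S∈X , refl = ∈-++⁺ʳ (subsetsᴹ (X ++ Y)) (∈-map⁺ (x ∷_) (subsets-++⁺ X Y S∈X T∈))

  subsets-++⁻ : (X Y : List (Mon n)) {U : List (Mon n)} → U ∈ subsetsᴹ (X ++ Y) →
    ∃₂ λ S T → S ∈ subsetsᴹ X × T ∈ subsetsᴹ Y × U ≡ S ++ T
  subsets-++⁻ []      Y {U} U∈ = [] , U , here refl , U∈ , refl
  subsets-++⁻ (x ∷ X) Y U∈ with ∈-++⁻ (subsetsᴹ (X ++ Y)) U∈
  ... | inj₁ U∈X++Y =
    let S , T , S∈ , T∈ , U≡ = subsets-++⁻ X Y U∈X++Y
    in S , T , ∈-++⁺ˡ S∈ , T∈ , U≡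
  ... | inj₂ U∈x∷X++Y with ∈-map⁻ (x ∷_) U∈x∷X++Y
  ...   | _ , U∈X++Y , refl =
    let S , T , S∈ , T∈ , U≡ = subsets-++⁻ X Y U∈X++Y
    in x ∷ S , T , ∈-++⁺ʳ (subsetsᴹ X) (∈-map⁺ (x ∷_) S∈) , T∈ , cong (x ∷_) U≡

  lcmList-++ : (S T : List (Mon n)) → lcmList (S ++ T) ≡ lcm (lcmList S) (lcmList T)
  lcmList-++ []      T = sym (zipWith-identityˡ ℕP.⊔-identityˡ (lcmList T))
  lcmList-++ (s ∷ S) T = trans (cong (lcm s) (lcmList-++ S T)) (sym (zipWith-assoc ℕP.⊔-assoc s _ _))

  ∈lcmLattice⁺ : (X : List (Mon n)) {S : List (Mon n)} → S ∈ subsetsᴹ X → lcmList S ∈ lcmLattice X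
  ∈lcmLattice⁺ X S∈ = ∈-deduplicate⁺ _≟_ (∈-map⁺ lcmList S∈)

  ∈lcmLattice⁻ : (X : List (Mon n)) {z : Mon n} → z ∈ lcmLattice X →
    ∃ λ S → S ∈ subsetsᴹ X × z ≡ lcmList S
  ∈lcmLattice⁻ X z∈ = ∈-map⁻ lcmList (∈-deduplicate⁻ _≟_ (map lcmList (subsetsᴹ X)) z∈)

  lcmLattice-unique : (X : List (Mon n)) → Unique (lcmLattice X)
  lcmLattice-unique X = Unique.deduplicate-! _≟_ (map lcmList (subsetsᴹ X))

module CoprimeLattices {n : ℕ} (X Y : List (Mon n))
  (X⊥Y : ∀ {ξ η} → ξ ∈ X → η ∈ Y → Coprime ξ η) where

  lcmList-disjoint-subsets : ∀ {S T} → S ∈ subsetsᴹ X → T ∈ subsetsᴹ Y →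
    Disjoint (lcmList S) (lcmList T)
  lcmList-disjoint-subsets {S} {T} S∈ T∈ = lcmList-disjoint S λ s∈S →
    disjoint-sym (lcmList-disjoint T λ t∈T →
      disjoint-sym (coprime⇒disjoint (X⊥Y (∈subsets⇒⊆ X S∈ s∈S) (∈subsets⇒⊆ Y T∈ t∈T))))

  lcmList-++-subsets : ∀ {S T} → S ∈ subsetsᴹ X → T ∈ subsetsᴹ Y →
    lcmList (S ++ T) ≡ lcmList S · lcmList T
  lcmList-++-subsets {S} {T} S∈ T∈ =
    trans (lcmList-++ S T) (lcm≡·-disjoint (lcmList-disjoint-subsets S∈ T∈))

  lcmLattice-disjoint : ∀ {x y} → x ∈ lcmLattice X → y ∈ lcmLattice Y → Disjoint x y
  lcmLattice-disjoint x∈ y∈ with ∈lcmLattice⁻ X x∈ | ∈lcmLattice⁻ Y y∈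
  ... | _ , S∈ , refl | _ , T∈ , refl = lcmList-disjoint-subsets S∈ T∈

  lcmLattice-·∈ : ∀ {x y} → x ∈ lcmLattice X → y ∈ lcmLattice Y → (x · y) ∈ lcmLattice (X ++ Y)
  lcmLattice-·∈ x∈ y∈ with ∈lcmLattice⁻ X x∈ | ∈lcmLattice⁻ Y y∈
  ... | _ , S∈ , refl | _ , T∈ , refl =
    subst (_∈ lcmLattice (X ++ Y)) (lcmList-++-subsets S∈ T∈)
      (∈lcmLattice⁺ (X ++ Y) (subsets-++⁺ X Y S∈ T∈))

  lcmLattice-factor : ∀ {z} → z ∈ lcmLattice (X ++ Y) →
    ∃₂ λ x y → x ∈ lcmLattice X × y ∈ lcmLattice Y × z ≡ x · y
  lcmLattice-factor z∈ with ∈lcmLattice⁻ (X ++ Y) z∈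
  ... | U , U∈ , refl with subsets-++⁻ X Y U∈
  ...   | S , T , S∈ , T∈ , refl =
    lcmList S , lcmList T , ∈lcmLattice⁺ X S∈ , ∈lcmLattice⁺ Y T∈ , lcmList-++-subsets S∈ T∈

module _ {n : ℕ} where

  graph : (Mon n → ℤ) → List (Mon n) → Poly {n}
  graph f = map (λ x → (f x , x))

  coeff-graph : (f : Mon n → ℤ) (L : List (Mon n)) (m : Mon n) →
    coeff (graph f L) m ≡ ∑[ x ∈ L ] δ (x ≟ m) (f x)
  coeff-graph f L m = trans (∑-filter (λ t → proj₂ t ≟ m) (graph f L) proj₁) (∑-map _ L _)

  coeff-*-graph : (f g : Mon n → ℤ) (L K : List (Mon n)) (m : Mon n) →
    coeff (graph f L * graph g K) m ≡ ∑[ x ∈ L ] ∑[ y ∈ K ] δ ((x · y) ≟ m) (f x ℤ.* g y)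
  coeff-*-graph f g L K m = begin
    coeff (graph f L * graph g K) m
      ≡⟨ ∑-filter (λ t → proj₂ t ≟ m) (graph f L * graph g K) proj₁ ⟩
    ∑ (graph f L * graph g K) coeffₘ
      ≡⟨ ∑-concatMap (λ s → map (times s) (graph g K)) (graph f L) coeffₘ ⟩
    ∑[ s ∈ graph f L ] ∑ (map (times s) (graph g K)) coeffₘ
      ≡⟨ ∑-map _ L _ ⟩
    ∑[ x ∈ L ] ∑ (map (times (f x , x)) (graph g K)) coeffₘ
      ≡⟨ ∑-cong L (λ {x} _ → trans (∑-map _ (graph g K) coeffₘ) (∑-map _ K _)) ⟩
    ∑[ x ∈ L ] ∑[ y ∈ K ] δ ((x · y) ≟ m) (f x ℤ.* g y) ∎
    where
    open ≡-Reasoning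
    coeffₘ : ℤ × Mon n → ℤ
    coeffₘ t = δ (proj₂ t ≟ m) (proj₁ t)
    times : ℤ × Mon n → ℤ × Mon n → ℤ × Mon n
    times s t = (proj₁ s ℤ.* proj₁ t , proj₂ s · proj₂ t)

lemma3p1 : (n : ℕ) (X Y : List (Mon n)) →
    (∀ {ξ η} → ξ ∈ X → η ∈ Y → Coprime ξ η) →
    M (X ++ Y) ≈ (M X * M Y)
lemma3p1 n X Y X⊥Y m = begin
  coeff (M (X ++ Y)) m
    ≡⟨ coeff-graph (μ R) R m ⟩
  ∑[ z ∈ R ] δ (z ≟ m) (μ R z)
    ≡⟨ ∑-R≡∑∑ _ ⟩
  ∑[ x ∈ P ] ∑[ y ∈ Q ] δ ((x · y) ≟ m) (μ R (x · y))
    ≡⟨ ∑-cong P (λ x∈P → ∑-cong Q (λ y∈Q → cong (δ _) (μ-multiplicative x∈P y∈Q))) ⟩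
  ∑[ x ∈ P ] ∑[ y ∈ Q ] δ ((x · y) ≟ m) (μ P x ℤ.* μ Q y)
    ≡⟨ coeff-*-graph (μ P) (μ Q) P Q m ⟨
  coeff (M X * M Y) m ∎
  where
  open ≡-Reasoning
  open CoprimeLattices X Y X⊥Y
  P Q R : List (Mon n)
  P = lcmLattice X
  Q = lcmLattice Y
  R = lcmLattice (X ++ Y)
  open Product P Q R (lcmLattice-unique X) (lcmLattice-unique Y) (lcmLattice-unique (X ++ Y))
    lcmLattice-disjoint lcmLattice-·∈ lcmLattice-factor
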